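{- In the call-by-value $\lambda$-calculus with callcc, abort and context variables, for all programs $p,q$, every context variable $k$ and every program context $F$: if $p\to q$, then $p\{F/k\}\to q\{F/k\}$.
   Context: Syntax: variables $x,y,z$; context variables $k$ (a separate set). Terms $t,s::=x\mid\lambda x.t\mid t\,s\mid\mathcal C\mid\mathcal A\,p$; values $v,w::=x\mid\lambda x.t\mid\mathcal C$ ($\mathcal C$ is callcc, $\mathcal A$ is abort); programs $p,q::=t\mid k\,t$; evaluation contexts $E::=[\,]\mid v\,E\mid E\,t$; program contexts $F::=E\mid k\,E$. $F[t]$ denotes plugging (a program). Terms modulo $\alpha$-conversion, $p\{v/x\}$ capture-avoiding substitution. Reduction on programs: $F[(\lambda x.t)\,v]\to F[t\{v/x\}]$; $F[\mathcal C\,v]\to F[v\,(\lambda y.\mathcal A\,F[y])]$ with $y$ not free in $F$; $F[\mathcal A\,p]\to p$. Context substitution $p\{F/k\}$: $(k\,t)\{F/k\}=F[t\{F/k\}]$; $(k'\,t)\{F/k\}=k'\,(t\{F/k\})$ for $k'\neq k$; on a program that is a term, and on terms, it is applied recursively to all subterms and subprograms (e.g. $(\mathcal A\,p)\{F/k\}=\mathcal A\,(p\{F/k\})$, $(\lambda x.t)\{F/k\}=\lambda x.(t\{F/k\})$, variables and $\mathcal C$ unchanged). -}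

module Defs where

open import Data.Nat using (ℕ; zero; suc)
open import Data.Nat using (_≟_)
open import Relation.Nullary using (yes; no)

-- Term variables: de Bruijn indices (terms modulo α-conversion).
-- Context variables k: names (natural numbers); they are never bound.

mutual
  data Term : Set where
    var  : ℕ → Term
    lam  : Term → Term
    app  : Term → Term → Term
    cc   : Term
    ab   : Prog → Term

  data Prog : Set where
    trm   : Term → Prog
    throw : ℕ → Term → Prog

data Val : Set where
  vvar : ℕ → Val
  vlam : Term → Val
  vcc  : Val

⌜_⌝ : Val → Term
⌜ vvar x ⌝ = var x
⌜ vlam t ⌝ = lam t
⌜ vcc ⌝    = cc

data ECtx : Set where
  hole : ECtx
  appR : Val → ECtx → ECtx
  appL : ECtx → Term → ECtx

data PCtx : Set where
  plain : ECtx → PCtx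
  cont  : ℕ → ECtx → PCtx

ext : (ℕ → ℕ) → ℕ → ℕ
ext ρ zero    = zero
ext ρ (suc n) = suc (ρ n)

mutual
  ren : (ℕ → ℕ) → Term → Term
  ren ρ (var x)   = var (ρ x)
  ren ρ (lam t)   = lam (ren (ext ρ) t)
  ren ρ (app t s) = app (ren ρ t) (ren ρ s)
  ren ρ cc        = cc
  ren ρ (ab p)    = ab (renP ρ p)

  renP : (ℕ → ℕ) → Prog → Prog
  renP ρ (trm t)     = trm (ren ρ t)
  renP ρ (throw k t) = throw k (ren ρ t)

renV : (ℕ → ℕ) → Val → Val
renV ρ (vvar x) = vvar (ρ x)
renV ρ (vlam t) = vlam (ren (ext ρ) t)
renV ρ vcc      = vcc

renE : (ℕ → ℕ) → ECtx → ECtx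
renE ρ hole       = hole
renE ρ (appR v E) = appR (renV ρ v) (renE ρ E)
renE ρ (appL E t) = appL (renE ρ E) (ren ρ t)

renF : (ℕ → ℕ) → PCtx → PCtx
renF ρ (plain E)  = plain (renE ρ E)
renF ρ (cont k E) = cont k (renE ρ E)

exts : (ℕ → Term) → ℕ → Term
exts σ zero    = var zero
exts σ (suc n) = ren suc (σ n)

mutual
  sub : (ℕ → Term) → Term → Term
  sub σ (var x)   = σ x
  sub σ (lam t)   = lam (sub (exts σ) t)
  sub σ (app t s) = app (sub σ t) (sub σ s)
  sub σ cc        = cc
  sub σ (ab p)    = ab (subP σ p)

  subP : (ℕ → Term) → Prog → Prog
  subP σ (trm t)     = trm (sub σ t)
  subP σ (throw k t) = throw k (sub σ t)

single : Term → ℕ → Term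
single v zero    = v
single v (suc n) = var n

-- t{v/x} where x is the variable bound by the enclosing λ (index 0)
_[_] : Term → Term → Term
t [ v ] = sub (single v) t

plugE : ECtx → Term → Term
plugE hole       t = t
plugE (appR v E) t = app ⌜ v ⌝ (plugE E t)
plugE (appL E s) t = app (plugE E t) s

plug : PCtx → Term → Prog
plug (plain E)  t = trm (plugE E t)
plug (cont k E) t = throw k (plugE E t)

-- Context substitution p{F/k} -------------------------------------------
-- Under a λ the free term variables of F are shifted (capture avoidance).

mutual
  csub : ℕ → PCtx → Term → Term
  csub k F (var x)   = var x
  csub k F (lam t)   = lam (csub k (renF suc F) t)
  csub k F (app t s) = app (csub k F t) (csub k F s)
  csub k F cc        = cc
  csub k F (ab p)    = ab (csubP k F p)

  csubP : ℕ → PCtx → Prog → Prog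
  csubP k F (trm t) = trm (csub k F t)
  csubP k F (throw k′ t) with k ≟ k′
  ... | yes _ = plug F (csub k F t)
  ... | no  _ = throw k′ (csub k F t)

data _⟶_ : Prog → Prog → Set where
  β     : (F : PCtx) (t : Term) (v : Val) →
          plug F (app (lam t) ⌜ v ⌝) ⟶ plug F (t [ ⌜ v ⌝ ])
  callcc : (F : PCtx) (v : Val) →
          plug F (app cc ⌜ v ⌝) ⟶
          plug F (app ⌜ v ⌝ (lam (ab (plug (renF suc F) (var zero)))))
  abort : (F : PCtx) (p : Prog) →
          plug F (ab p) ⟶ p

-- Context substitution p ↦ p{H/k} commutes with each ingredient of a reduction step.
-- It sends a program context F to a program context F{H/k} (a context k E becomes the
-- composite H[E{H/k}]) so that F[t]{H/k} = F{H/k}[t{H/k}]; it sends values to values;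
-- it commutes with renaming; and it commutes with β-substitution,
-- t{v/x}{H/k} = t{H/k}{v{H/k}/x}. Hence the image of a redex in a program context is a
-- redex of the same kind in the image context, and its contractum is the image of the
-- original contractum.
module Submission where

open import Data.Nat using (ℕ; zero; suc; _≟_)
open import Function using (_∘_)
open import Relation.Nullary using (yes; no)
open import Relation.Binary.PropositionalEquality
  using (_≡_; refl; sym; trans; cong; cong₂; module ≡-Reasoning)
open import Defs

ext-cong : ∀ {ρ ρ′ : ℕ → ℕ} → (∀ x → ρ x ≡ ρ′ x) → ∀ x → ext ρ x ≡ ext ρ′ x
ext-cong eq zero    = refl
ext-cong eq (suc x) = cong suc (eq x)

ext-ext : ∀ (ρ ρ′ : ℕ → ℕ) x → ext ρ (ext ρ′ x) ≡ ext (ρ ∘ ρ′) x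
ext-ext ρ ρ′ zero    = refl
ext-ext ρ ρ′ (suc x) = refl

mutual
  ren-cong : ∀ {ρ ρ′} → (∀ x → ρ x ≡ ρ′ x) → ∀ t → ren ρ t ≡ ren ρ′ t
  ren-cong eq (var x)   = cong var (eq x)
  ren-cong eq (lam t)   = cong lam (ren-cong (ext-cong eq) t)
  ren-cong eq (app t s) = cong₂ app (ren-cong eq t) (ren-cong eq s)
  ren-cong eq cc        = refl
  ren-cong eq (ab p)    = cong ab (renP-cong eq p)

  renP-cong : ∀ {ρ ρ′} → (∀ x → ρ x ≡ ρ′ x) → ∀ p → renP ρ p ≡ renP ρ′ p
  renP-cong eq (trm t)     = cong trm (ren-cong eq t)
  renP-cong eq (throw k t) = cong (throw k) (ren-cong eq t)

mutual
  ren-ren : ∀ ρ ρ′ t → ren ρ (ren ρ′ t) ≡ ren (ρ ∘ ρ′) t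
  ren-ren ρ ρ′ (var x)   = refl
  ren-ren ρ ρ′ (lam t)   =
    cong lam (trans (ren-ren (ext ρ) (ext ρ′) t) (ren-cong (ext-ext ρ ρ′) t))
  ren-ren ρ ρ′ (app t s) = cong₂ app (ren-ren ρ ρ′ t) (ren-ren ρ ρ′ s)
  ren-ren ρ ρ′ cc        = refl
  ren-ren ρ ρ′ (ab p)    = cong ab (renP-ren ρ ρ′ p)

  renP-ren : ∀ ρ ρ′ p → renP ρ (renP ρ′ p) ≡ renP (ρ ∘ ρ′) p
  renP-ren ρ ρ′ (trm t)     = cong trm (ren-ren ρ ρ′ t)
  renP-ren ρ ρ′ (throw k t) = cong (throw k) (ren-ren ρ ρ′ t)

exts-cong : ∀ {σ σ′ : ℕ → Term} → (∀ x → σ x ≡ σ′ x) → ∀ x → exts σ x ≡ exts σ′ x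
exts-cong eq zero    = refl
exts-cong eq (suc x) = cong (ren suc) (eq x)

mutual
  sub-cong : ∀ {σ σ′} → (∀ x → σ x ≡ σ′ x) → ∀ t → sub σ t ≡ sub σ′ t
  sub-cong eq (var x)   = eq x
  sub-cong eq (lam t)   = cong lam (sub-cong (exts-cong eq) t)
  sub-cong eq (app t s) = cong₂ app (sub-cong eq t) (sub-cong eq s)
  sub-cong eq cc        = refl
  sub-cong eq (ab p)    = cong ab (subP-cong eq p)

  subP-cong : ∀ {σ σ′} → (∀ x → σ x ≡ σ′ x) → ∀ p → subP σ p ≡ subP σ′ p
  subP-cong eq (trm t)     = cong trm (sub-cong eq t)
  subP-cong eq (throw k t) = cong (throw k) (sub-cong eq t)

exts-ext : ∀ σ ρ x → exts σ (ext ρ x) ≡ exts (σ ∘ ρ) x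
exts-ext σ ρ zero    = refl
exts-ext σ ρ (suc x) = refl

mutual
  sub-ren : ∀ σ ρ t → sub σ (ren ρ t) ≡ sub (σ ∘ ρ) t
  sub-ren σ ρ (var x)   = refl
  sub-ren σ ρ (lam t)   =
    cong lam (trans (sub-ren (exts σ) (ext ρ) t) (sub-cong (exts-ext σ ρ) t))
  sub-ren σ ρ (app t s) = cong₂ app (sub-ren σ ρ t) (sub-ren σ ρ s)
  sub-ren σ ρ cc        = refl
  sub-ren σ ρ (ab p)    = cong ab (subP-ren σ ρ p)

  subP-ren : ∀ σ ρ p → subP σ (renP ρ p) ≡ subP (σ ∘ ρ) p
  subP-ren σ ρ (trm t)     = cong trm (sub-ren σ ρ t)
  subP-ren σ ρ (throw k t) = cong (throw k) (sub-ren σ ρ t)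

ren-exts : ∀ ρ σ x → ren (ext ρ) (exts σ x) ≡ exts (ren ρ ∘ σ) x
ren-exts ρ σ zero    = refl
ren-exts ρ σ (suc x) = trans (ren-ren (ext ρ) suc (σ x)) (sym (ren-ren suc ρ (σ x)))

mutual
  ren-sub : ∀ ρ σ t → ren ρ (sub σ t) ≡ sub (ren ρ ∘ σ) t
  ren-sub ρ σ (var x)   = refl
  ren-sub ρ σ (lam t)   =
    cong lam (trans (ren-sub (ext ρ) (exts σ) t) (sub-cong (ren-exts ρ σ) t))
  ren-sub ρ σ (app t s) = cong₂ app (ren-sub ρ σ t) (ren-sub ρ σ s)
  ren-sub ρ σ cc        = refl
  ren-sub ρ σ (ab p)    = cong ab (renP-sub ρ σ p)

  renP-sub : ∀ ρ σ p → renP ρ (subP σ p) ≡ subP (ren ρ ∘ σ) p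
  renP-sub ρ σ (trm t)     = cong trm (ren-sub ρ σ t)
  renP-sub ρ σ (throw k t) = cong (throw k) (ren-sub ρ σ t)

exts-var : ∀ x → exts var x ≡ var x
exts-var zero    = refl
exts-var (suc x) = refl

mutual
  sub-id : ∀ t → sub var t ≡ t
  sub-id (var x)   = refl
  sub-id (lam t)   = cong lam (trans (sub-cong exts-var t) (sub-id t))
  sub-id (app t s) = cong₂ app (sub-id t) (sub-id s)
  sub-id cc        = refl
  sub-id (ab p)    = cong ab (subP-id p)

  subP-id : ∀ p → subP var p ≡ p
  subP-id (trm t)     = cong trm (sub-id t)
  subP-id (throw k t) = cong (throw k) (sub-id t)

sub-exts-ren-suc : ∀ σ t → sub (exts σ) (ren suc t) ≡ ren suc (sub σ t)
sub-exts-ren-suc σ t = trans (sub-ren (exts σ) suc t) (sym (ren-sub suc σ t))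

sub-single-ren-suc : ∀ w t → sub (single w) (ren suc t) ≡ t
sub-single-ren-suc w t = trans (sub-ren (single w) suc t) (sub-id t)

lam-injective : ∀ {t u} → lam t ≡ lam u → t ≡ u
lam-injective refl = refl

⌜renV⌝ : ∀ ρ v → ⌜ renV ρ v ⌝ ≡ ren ρ ⌜ v ⌝
⌜renV⌝ ρ (vvar x) = refl
⌜renV⌝ ρ (vlam t) = refl
⌜renV⌝ ρ vcc      = refl

renV-ren : ∀ ρ ρ′ v → renV ρ (renV ρ′ v) ≡ renV (ρ ∘ ρ′) v
renV-ren ρ ρ′ (vvar x) = refl
renV-ren ρ ρ′ (vlam t) = cong vlam (lam-injective (ren-ren ρ ρ′ (lam t)))
renV-ren ρ ρ′ vcc      = refl

renE-ren : ∀ ρ ρ′ E → renE ρ (renE ρ′ E) ≡ renE (ρ ∘ ρ′) E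
renE-ren ρ ρ′ hole       = refl
renE-ren ρ ρ′ (appR v E) = cong₂ appR (renV-ren ρ ρ′ v) (renE-ren ρ ρ′ E)
renE-ren ρ ρ′ (appL E t) = cong₂ appL (renE-ren ρ ρ′ E) (ren-ren ρ ρ′ t)

renF-ren : ∀ ρ ρ′ F → renF ρ (renF ρ′ F) ≡ renF (ρ ∘ ρ′) F
renF-ren ρ ρ′ (plain E)  = cong plain (renE-ren ρ ρ′ E)
renF-ren ρ ρ′ (cont k E) = cong (cont k) (renE-ren ρ ρ′ E)

-- Both sides equal renF (suc ∘ ρ) F: suc ∘ ρ and ext ρ ∘ suc agree definitionally.
renF-suc-ext : ∀ ρ F → renF suc (renF ρ F) ≡ renF (ext ρ) (renF suc F)
renF-suc-ext ρ F = trans (renF-ren suc ρ F) (sym (renF-ren (ext ρ) suc F))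

plugE-ren : ∀ ρ E u → ren ρ (plugE E u) ≡ plugE (renE ρ E) (ren ρ u)
plugE-ren ρ hole       u = refl
plugE-ren ρ (appR v E) u = cong₂ app (sym (⌜renV⌝ ρ v)) (plugE-ren ρ E u)
plugE-ren ρ (appL E t) u = cong₂ app (plugE-ren ρ E u) refl

plug-ren : ∀ ρ F u → renP ρ (plug F u) ≡ plug (renF ρ F) (ren ρ u)
plug-ren ρ (plain E)  u = cong trm (plugE-ren ρ E u)
plug-ren ρ (cont k E) u = cong (throw k) (plugE-ren ρ E u)

mutual
  csub-ren : ∀ k ρ F t → csub k (renF ρ F) (ren ρ t) ≡ ren ρ (csub k F t)
  csub-ren k ρ F (var x)   = refl
  csub-ren k ρ F (lam t)   = cong lam (trans
    (cong (λ G → csub k G (ren (ext ρ) t)) (renF-suc-ext ρ F))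
    (csub-ren k (ext ρ) (renF suc F) t))
  csub-ren k ρ F (app t s) = cong₂ app (csub-ren k ρ F t) (csub-ren k ρ F s)
  csub-ren k ρ F cc        = refl
  csub-ren k ρ F (ab p)    = cong ab (csubP-ren k ρ F p)

  csubP-ren : ∀ k ρ F p → csubP k (renF ρ F) (renP ρ p) ≡ renP ρ (csubP k F p)
  csubP-ren k ρ F (trm t) = cong trm (csub-ren k ρ F t)
  csubP-ren k ρ F (throw k′ t) with k ≟ k′
  ... | yes _ = trans (cong (plug (renF ρ F)) (csub-ren k ρ F t))
                      (sym (plug-ren ρ F (csub k F t)))
  ... | no  _ = cong (throw k′) (csub-ren k ρ F t)

-- Substitution need not send a value to a value, so it does not act on contexts;
-- instead we record when σ maps one context onto another.
data MapsE (σ : ℕ → Term) : ECtx → ECtx → Set where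
  hole : MapsE σ hole hole
  appR : ∀ {v w E E′} → sub σ ⌜ v ⌝ ≡ ⌜ w ⌝ → MapsE σ E E′ →
         MapsE σ (appR v E) (appR w E′)
  appL : ∀ {E E′ t t′} → MapsE σ E E′ → sub σ t ≡ t′ →
         MapsE σ (appL E t) (appL E′ t′)

data MapsF (σ : ℕ → Term) : PCtx → PCtx → Set where
  plain : ∀ {E E′} → MapsE σ E E′ → MapsF σ (plain E) (plain E′)
  cont  : ∀ {E E′} k → MapsE σ E E′ → MapsF σ (cont k E) (cont k E′)

plugE-sub : ∀ {σ E E′} → MapsE σ E E′ → ∀ u → sub σ (plugE E u) ≡ plugE E′ (sub σ u)
plugE-sub hole          u = refl
plugE-sub (appR eq m)   u = cong₂ app eq (plugE-sub m u)
plugE-sub (appL m eq)   u = cong₂ app (plugE-sub m u) eq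

plug-sub : ∀ {σ F F′} → MapsF σ F F′ → ∀ u → subP σ (plug F u) ≡ plug F′ (sub σ u)
plug-sub (plain m)  u = cong trm (plugE-sub m u)
plug-sub (cont k m) u = cong (throw k) (plugE-sub m u)

MapsE-exts : ∀ {σ E E′} → MapsE σ E E′ → MapsE (exts σ) (renE suc E) (renE suc E′)
MapsE-exts {σ} hole = hole
MapsE-exts {σ} (appR {v} {w} eq m) = appR eq′ (MapsE-exts m)
  where
  open ≡-Reasoning
  eq′ : sub (exts σ) ⌜ renV suc v ⌝ ≡ ⌜ renV suc w ⌝
  eq′ = begin
    sub (exts σ) ⌜ renV suc v ⌝  ≡⟨ cong (sub (exts σ)) (⌜renV⌝ suc v) ⟩
    sub (exts σ) (ren suc ⌜ v ⌝) ≡⟨ sub-exts-ren-suc σ ⌜ v ⌝ ⟩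
    ren suc (sub σ ⌜ v ⌝)        ≡⟨ cong (ren suc) eq ⟩
    ren suc ⌜ w ⌝                ≡⟨ sym (⌜renV⌝ suc w) ⟩
    ⌜ renV suc w ⌝               ∎
MapsE-exts {σ} (appL {t = t} m eq) =
  appL (MapsE-exts m) (trans (sub-exts-ren-suc σ t) (cong (ren suc) eq))

MapsF-exts : ∀ {σ F F′} → MapsF σ F F′ → MapsF (exts σ) (renF suc F) (renF suc F′)
MapsF-exts (plain m)  = plain (MapsE-exts m)
MapsF-exts (cont k m) = cont k (MapsE-exts m)

MapsE-single : ∀ w E → MapsE (single w) (renE suc E) E
MapsE-single w hole       = hole
MapsE-single w (appR v E) = appR
  (trans (cong (sub (single w)) (⌜renV⌝ suc v)) (sub-single-ren-suc w ⌜ v ⌝))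
  (MapsE-single w E)
MapsE-single w (appL E t) = appL (MapsE-single w E) (sub-single-ren-suc w t)

MapsF-single : ∀ w F → MapsF (single w) (renF suc F) F
MapsF-single w (plain E)  = plain (MapsE-single w E)
MapsF-single w (cont k E) = cont k (MapsE-single w E)

-- Generalised from β-substitution (where G = renF suc F) to an invariant that survives
-- going under λ, where F and G are renamed and σ, σ′ extended.
mutual
  csub-sub : ∀ {k F G σ σ′} → MapsF σ′ G F → (∀ x → csub k F (σ x) ≡ σ′ x) →
             ∀ t → csub k F (sub σ t) ≡ sub σ′ (csub k G t)
  csub-sub m eq (var x)   = eq x
  csub-sub {k} {F} {σ = σ} {σ′} m eq (lam t) =
    cong lam (csub-sub (MapsF-exts m) eq′ t)
    where
    eq′ : ∀ x → csub k (renF suc F) (exts σ x) ≡ exts σ′ x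
    eq′ zero    = refl
    eq′ (suc x) = trans (csub-ren k suc F (σ x)) (cong (ren suc) (eq x))
  csub-sub m eq (app t s) = cong₂ app (csub-sub m eq t) (csub-sub m eq s)
  csub-sub m eq cc        = refl
  csub-sub m eq (ab p)    = cong ab (csubP-sub m eq p)

  csubP-sub : ∀ {k F G σ σ′} → MapsF σ′ G F → (∀ x → csub k F (σ x) ≡ σ′ x) →
              ∀ p → csubP k F (subP σ p) ≡ subP σ′ (csubP k G p)
  csubP-sub m eq (trm t) = cong trm (csub-sub m eq t)
  csubP-sub {k} m eq (throw k′ t) with k ≟ k′
  ... | yes _ = trans (cong (plug _) (csub-sub m eq t)) (sym (plug-sub m _))
  ... | no  _ = cong (throw k′) (csub-sub m eq t)

csub-[] : ∀ k F t v → csub k F (t [ v ]) ≡ csub k (renF suc F) t [ csub k F v ]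
csub-[] k F t v = csub-sub (MapsF-single (csub k F v) F) csub-single t
  where
  csub-single : ∀ x → csub k F (single v x) ≡ single (csub k F v) x
  csub-single zero    = refl
  csub-single (suc x) = refl

csubV : ℕ → PCtx → Val → Val
csubV k H (vvar x) = vvar x
csubV k H (vlam t) = vlam (csub k (renF suc H) t)
csubV k H vcc      = vcc

⌜csubV⌝ : ∀ k H v → ⌜ csubV k H v ⌝ ≡ csub k H ⌜ v ⌝
⌜csubV⌝ k H (vvar x) = refl
⌜csubV⌝ k H (vlam t) = refl
⌜csubV⌝ k H vcc      = refl

csubE : ℕ → PCtx → ECtx → ECtx
csubE k H hole       = hole
csubE k H (appR v E) = appR (csubV k H v) (csubE k H E)
csubE k H (appL E t) = appL (csubE k H E) (csub k H t)

compE : ECtx → ECtx → ECtx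
compE hole        E = E
compE (appR v E₀) E = appR v (compE E₀ E)
compE (appL E₀ t) E = appL (compE E₀ E) t

compF : PCtx → ECtx → PCtx
compF (plain E₀)  E = plain (compE E₀ E)
compF (cont k E₀) E = cont k (compE E₀ E)

csubF : ℕ → PCtx → PCtx → PCtx
csubF k H (plain E) = plain (csubE k H E)
csubF k H (cont k′ E) with k ≟ k′
... | yes _ = compF H (csubE k H E)
... | no  _ = cont k′ (csubE k H E)

plugE-compE : ∀ E₀ E u → plugE (compE E₀ E) u ≡ plugE E₀ (plugE E u)
plugE-compE hole        E u = refl
plugE-compE (appR v E₀) E u = cong (app ⌜ v ⌝) (plugE-compE E₀ E u)
plugE-compE (appL E₀ t) E u = cong₂ app (plugE-compE E₀ E u) refl

plug-compF : ∀ H E u → plug (compF H E) u ≡ plug H (plugE E u)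
plug-compF (plain E₀)  E u = cong trm (plugE-compE E₀ E u)
plug-compF (cont k E₀) E u = cong (throw k) (plugE-compE E₀ E u)

csub-plugE : ∀ k H E u → csub k H (plugE E u) ≡ plugE (csubE k H E) (csub k H u)
csub-plugE k H hole       u = refl
csub-plugE k H (appR v E) u = cong₂ app (sym (⌜csubV⌝ k H v)) (csub-plugE k H E u)
csub-plugE k H (appL E t) u = cong₂ app (csub-plugE k H E u) refl

csubP-plug : ∀ k H F u → csubP k H (plug F u) ≡ plug (csubF k H F) (csub k H u)
csubP-plug k H (plain E) u = cong trm (csub-plugE k H E u)
csubP-plug k H (cont k′ E) u with k ≟ k′
... | yes _ = trans (cong (plug H) (csub-plugE k H E u))
                    (sym (plug-compF H (csubE k H E) (csub k H u)))
... | no  _ = cong (throw k′) (csub-plugE k H E u)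

csubV-ren : ∀ k ρ H v → csubV k (renF ρ H) (renV ρ v) ≡ renV ρ (csubV k H v)
csubV-ren k ρ H (vvar x) = refl
csubV-ren k ρ H (vlam t) = cong vlam (lam-injective (csub-ren k ρ H (lam t)))
csubV-ren k ρ H vcc      = refl

csubE-ren : ∀ k ρ H E → csubE k (renF ρ H) (renE ρ E) ≡ renE ρ (csubE k H E)
csubE-ren k ρ H hole       = refl
csubE-ren k ρ H (appR v E) = cong₂ appR (csubV-ren k ρ H v) (csubE-ren k ρ H E)
csubE-ren k ρ H (appL E t) = cong₂ appL (csubE-ren k ρ H E) (csub-ren k ρ H t)

compE-ren : ∀ ρ E₀ E → compE (renE ρ E₀) (renE ρ E) ≡ renE ρ (compE E₀ E)
compE-ren ρ hole        E = refl
compE-ren ρ (appR v E₀) E = cong (appR (renV ρ v)) (compE-ren ρ E₀ E)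
compE-ren ρ (appL E₀ t) E = cong₂ appL (compE-ren ρ E₀ E) refl

compF-ren : ∀ ρ H E → compF (renF ρ H) (renE ρ E) ≡ renF ρ (compF H E)
compF-ren ρ (plain E₀)  E = cong plain (compE-ren ρ E₀ E)
compF-ren ρ (cont k E₀) E = cong (cont k) (compE-ren ρ E₀ E)

csubF-ren : ∀ k ρ H F → csubF k (renF ρ H) (renF ρ F) ≡ renF ρ (csubF k H F)
csubF-ren k ρ H (plain E) = cong plain (csubE-ren k ρ H E)
csubF-ren k ρ H (cont k′ E) with k ≟ k′
... | yes _ = trans (cong (compF (renF ρ H)) (csubE-ren k ρ H E))
                    (compF-ren ρ H (csubE k H E))
... | no  _ = cong (cont k′) (csubE-ren k ρ H E)

csubP-β : ∀ k H G t v →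
  csubP k H (plug G (app (lam t) ⌜ v ⌝)) ⟶ csubP k H (plug G (t [ ⌜ v ⌝ ]))
csubP-β k H G t v
  rewrite csubP-plug k H G (app (lam t) ⌜ v ⌝)
        | csubP-plug k H G (t [ ⌜ v ⌝ ])
        | csub-[] k H t ⌜ v ⌝
        | sym (⌜csubV⌝ k H v)
  = β (csubF k H G) (csub k (renF suc H) t) (csubV k H v)

csubP-callcc : ∀ k H G v →
  csubP k H (plug G (app cc ⌜ v ⌝)) ⟶
  csubP k H (plug G (app ⌜ v ⌝ (lam (ab (plug (renF suc G) (var zero))))))
csubP-callcc k H G v
  rewrite csubP-plug k H G (app cc ⌜ v ⌝)
        | csubP-plug k H G (app ⌜ v ⌝ (lam (ab (plug (renF suc G) (var zero)))))
        | csubP-plug k (renF suc H) (renF suc G) (var zero)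
        | csubF-ren k suc H G
        | sym (⌜csubV⌝ k H v)
  = callcc (csubF k H G) (csubV k H v)

csubP-abort : ∀ k H G p → csubP k H (plug G (ab p)) ⟶ csubP k H p
csubP-abort k H G p rewrite csubP-plug k H G (ab p) = abort (csubF k H G) (csubP k H p)

lemma5p3 : (p q : Prog) (k : ℕ) (F : PCtx) →
    p ⟶ q → csubP k F p ⟶ csubP k F q
lemma5p3 _ _ k H (β G t v)    = csubP-β k H G t v
lemma5p3 _ _ k H (callcc G v) = csubP-callcc k H G v
lemma5p3 _ _ k H (abort G p)  = csubP-abort k H G p
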